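{- Let $\Gamma$ be a finite simplicial complex and $1\le k\le\dim\Gamma$. If $\underline C_k$ is a coherent-down-component in dimension $k$, then there is no $(k+1)$-face containing a face of $\underline C_k$; that is, every $\underline\sigma\in\underline C_k$ is a leaf.
   Context: Simplicial complex: a set of nonempty subsets (faces) of a finite set containing all singletons and closed under nonempty subsets; $k$-faces have $k+1$ elements. Oriented $k$-faces ($k\ge1$): orderings of a $k$-face up to even permutations. For an oriented $k$-face $\sigma=[x_0,\dots,x_k]$ and an oriented $(k-1)$-face $\rho$ with support $\underline\sigma\setminus\{x_i\}$, $[\sigma:\rho]=+1$ iff $\rho$ equals $[x_0,\dots,\widehat{x_i},\dots,x_k]$ for $i$ even, resp. its opposite for $i$ odd, and $-1$ otherwise (for $k=1$, the oriented $0$-faces are $\pm[x]$). Two distinct $k$-faces are down-adjacent if their intersection is a $(k-1)$-face. A quotient-down-component in dimension $k$ is a maximal set of $k$-faces connected under the transitive closure of down-adjacency. It is a coherent-down-component if it is not a single vertex and there is a choice of orientation $\sigma$ of each $\underline\sigma$ in it such that $[\sigma:\rho]=[\sigma':\rho]$ whenever $\underline\sigma,\underline\sigma'$ lie in the component and both contain the $(k-1)$-face $\underline\rho$ ($\rho$ any fixed orientation of it). A leaf is a face contained in no larger face. -}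

module Defs where

open import Data.Nat using (ℕ; zero; suc; _+_)
open import Data.Fin using (Fin; _<?_)
open import Data.Fin.Properties using (_≟_)
open import Data.Fin.Subset using (Subset; _∩_; ⁅_⁆; Nonempty; ∣_∣; _⊆_) renaming (_∈_ to _∈ₛ_)
open import Data.List using (List; []; _∷_; length; filter)
open import Data.List.Relation.Unary.Unique.Propositional using (Unique)
open import Data.List.Membership.Propositional using (_∈_)
import Data.List.Membership.DecPropositional as DecMem
open import Data.Maybe using (Maybe; just; nothing)
import Data.Maybe as Maybe
open import Data.Product using (_×_; _,_; ∃; Σ)
open import Data.Sign using (Sign; opposite) renaming (_*_ to _*ₛ_)
import Data.Sign as S
open import Function.Bundles using (_⇔_)
open import Relation.Nullary using (¬_; yes; no)
open import Relation.Binary.PropositionalEquality using (_≡_)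
open import Relation.Binary.Construct.Closure.ReflexiveTransitive using (Star)

record SimplicialComplex (n : ℕ) : Set₁ where
  field
    Face        : Subset n → Set
    nonempty    : ∀ S → Face S → Nonempty S
    singletons  : ∀ x → Face ⁅ x ⁆
    downClosed  : ∀ S T → Face T → Nonempty S → S ⊆ T → Face S

open SimplicialComplex public

module _ {n : ℕ} (Γ : SimplicialComplex n) where

  KFace : ℕ → Subset n → Set
  KFace k S = Face Γ S × ∣ S ∣ ≡ suc k

  Leaf : Subset n → Set
  Leaf S = Face Γ S × (∀ T → Face Γ T → S ⊆ T → T ≡ S)

  DownAdj : ℕ → Subset n → Subset n → Set
  -- (the intersection, of size k, is a face; for k = 0 this is impossible as faces are nonempty)
  DownAdj k S T = KFace k S × KFace k T × ¬ (S ≡ T) × Face Γ (S ∩ T) × ∣ S ∩ T ∣ ≡ k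

  InComponent : ℕ → Subset n → Subset n → Set
  InComponent k σ₀ σ = Star (DownAdj k) σ₀ σ

-- An ordering (representative of an orientation) of a set S: a duplicate-free
-- list whose elements are exactly the elements of S.
IsOrdering : {n : ℕ} → List (Fin n) → Subset n → Set
IsOrdering ℓ S = Unique ℓ × (∀ x → (x ∈ ℓ) ⇔ (x ∈ₛ S))

inversions : {n : ℕ} → List (Fin n) → ℕ
inversions [] = 0
inversions (x ∷ xs) = length (filter (λ y → y <? x) xs) + inversions xs

signPow : ℕ → Sign
signPow zero = S.+
signPow (suc m) = opposite (signPow m)

missing : {n : ℕ} → List (Fin n) → List (Fin n) → Maybe (ℕ × List (Fin n))
missing [] ρ = nothing
missing {n} (x ∷ xs) ρ with DecMem._∈?_ (_≟_ {n}) x ρ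
... | no _ = just (0 , xs)
... | yes _ = Maybe.map (λ { (i , ys) → (suc i , x ∷ ys) }) (missing xs ρ)

-- incidence number [σ : ρ] for oriented σ = [x₀,…,x_k] and oriented ρ with support
-- σ̲ ∖ {x_i}: (-1)^i times the sign of the permutation taking [x₀,…,x̂ᵢ,…,x_k] to ρ,
-- the latter being (-1)^(inv(σ without xᵢ) + inv(ρ)).
-- (Only meaningful when the supports are as described.)
incidence : {n : ℕ} → List (Fin n) → List (Fin n) → Sign
incidence σ ρ with missing σ ρ
... | just (i , σ') = signPow (i + inversions σ' + inversions ρ)
... | nothing = S.+

module _ {n : ℕ} (Γ : SimplicialComplex n) where

  Coherent : ℕ → Subset n → Set
  Coherent (suc k) σ₀ =
    Σ (Subset n → List (Fin n)) λ o →
      (∀ σ → InComponent Γ (suc k) σ₀ σ → IsOrdering (o σ) σ) ×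
      (∀ σ σ' ρ̲ ρ → InComponent Γ (suc k) σ₀ σ → InComponent Γ (suc k) σ₀ σ' →
         KFace Γ k ρ̲ → ρ̲ ⊆ σ → ρ̲ ⊆ σ' → IsOrdering ρ ρ̲ →
         incidence (o σ) ρ ≡ incidence (o σ') ρ)
  -- in dimension 0 a component is a single vertex, never coherent
  Coherent zero σ₀ = Data.Empty.⊥
    where import Data.Empty

module Submission where

-- Suppose σ = {x, y} ∪ U lies in the component and in a face containing a vertex v ∉ σ.
-- Then A = {v, y} ∪ U and B = {v, x} ∪ U are faces down-adjacent to σ, so σ, A and B all
-- lie in the component and any two of them share a k-face.  For an ordering O of m ∷ R the
-- incidence [O : R] is (-1)^(inv O + #{r ∈ R ∣ r < m} + inv R), so coherence along each
-- shared k-face is a parity condition.  In the sum of the three conditions the orderings of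
-- σ, A and B each occur twice, and what remains is, up to even terms, one comparison for
-- each of the three pairs from {x, y, v}: an odd number, a contradiction.

open import Defs
open import Data.Nat using (ℕ; zero; suc; _+_)
open import Data.Nat.Properties using (+-suc; suc-injective)
open import Data.Nat.Tactic.RingSolver using (solve-∀)
open import Data.Fin using (Fin; _<_; _<?_)
open import Data.Fin.Properties using (<-cmp; <-asym; <-irrefl; _≟_)
open import Data.Fin.Subset using (Subset; ⁅_⁆; _∪_; _∩_; _⊆_; ∣_∣; inside; outside)
  renaming (⊥ to ∅; _∈_ to _∈ₛ_; _∉_ to _∉ₛ_)
open import Data.Fin.Subset.Properties
  using (_∈?_; ∉⊥; ∣⊥∣≡0; x∈⁅x⁆; x∈⁅y⁆⇒x≡y; x∈p∪q⁺; x∈p∪q⁻; x∈p∩q⁺; x∈p∩q⁻; q⊆p∪q; ⊆-antisym; ∪-assoc; ∪-comm; ∪-identityˡ)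
open import Data.Vec as Vec using (_∷_)
open import Data.List using (List; []; _∷_; _++_; length; filter)
open import Data.List.Properties using (filter-++; length-++; filter-accept; filter-reject)
open import Data.List.Relation.Unary.Any using (here; there)
open import Data.List.Relation.Unary.All using (All; []; _∷_)
open import Data.List.Relation.Unary.All.Properties using (All¬⇒¬Any; ¬Any⇒All¬)
open import Data.List.Relation.Unary.AllPairs using (_∷_)
open import Data.List.Relation.Unary.Unique.Propositional using (Unique)
open import Data.List.Relation.Unary.Unique.Propositional.Properties using (filter⁺)
open import Data.List.Membership.Propositional using (_∈_; _∉_)
open import Data.List.Membership.Propositional.Properties using (∈-filter⁺; ∈-filter⁻)
import Data.List.Membership.DecPropositional as DecMembership
import Data.List.Relation.Unary.All as All
open import Data.Maybe using (just)
open import Data.Product using (_,_; proj₁; proj₂; ∃₂; _×_)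
open import Data.Sum using (inj₁; inj₂; [_,_]′)
open import Data.Sign using (opposite; _*_)
import Data.Sign as Sign
open import Data.Sign.Properties using (s*s≡+; s≢opposite[s]; *-cancelʳ-≡; *-identityʳ; opposite-involutive)
open import Data.Empty using (⊥; ⊥-elim)
open import Function using (_∘_)
open import Function.Bundles using (mk⇔; Equivalence)
open import Relation.Binary.Definitions using (tri<; tri≈; tri>)
open import Relation.Nullary using (¬_; yes; no)
open import Relation.Nullary.Decidable using (decidable-stable)
open import Relation.Binary.Construct.Closure.ReflexiveTransitive using (ε; _◅_; _◅◅_)
open import Relation.Binary.PropositionalEquality
  using (_≡_; _≢_; refl; sym; trans; cong; cong₂; subst; ≢-sym; module ≡-Reasoning)
open ≡-Reasoning

private
  variable
    n : ℕ

opposite-*ˡ : ∀ s t → opposite (s * t) ≡ opposite s * t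
opposite-*ˡ Sign.+ t = refl
opposite-*ˡ Sign.- t = opposite-involutive t

signPow-+ : ∀ a b → signPow (a + b) ≡ signPow a * signPow b
signPow-+ zero    b = refl
signPow-+ (suc a) b = trans (cong opposite (signPow-+ a b)) (opposite-*ˡ (signPow a) (signPow b))

signPow-double : ∀ a → signPow (a + a) ≡ Sign.+
signPow-double a = trans (signPow-+ a a) (s*s≡+ (signPow a))

signPow-+-double : ∀ a c → signPow (a + (c + c)) ≡ signPow a
signPow-+-double a c = begin
  signPow (a + (c + c))           ≡⟨ signPow-+ a (c + c) ⟩
  signPow a * signPow (c + c)     ≡⟨ cong (signPow a *_) (signPow-double c) ⟩
  signPow a * Sign.+              ≡⟨ *-identityʳ (signPow a) ⟩
  signPow a                       ∎

signPow-cancelʳ : ∀ a b c → signPow (a + c) ≡ signPow (b + c) → signPow a ≡ signPow b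
signPow-cancelʳ a b c eq =
  *-cancelʳ-≡ (signPow c) (signPow a) (signPow b)
    (trans (sym (signPow-+ a c)) (trans eq (signPow-+ b c)))

signPow-sum-even : ∀ a b → signPow a ≡ signPow b → signPow (a + b) ≡ Sign.+
signPow-sum-even a b eq = trans (signPow-+ a b) (trans (cong (_* signPow b) eq) (s*s≡+ (signPow b)))

below : Fin n → List (Fin n) → ℕ
below m l = length (filter (_<? m) l)

below-∷-< : ∀ {m y : Fin n} l → y < m → below m (y ∷ l) ≡ suc (below m l)
below-∷-< {m = m} l y<m = cong length (filter-accept (_<? m) {xs = l} y<m)

below-∷-≮ : ∀ {m y : Fin n} l → ¬ y < m → below m (y ∷ l) ≡ below m l
below-∷-≮ {m = m} l y≮m = cong length (filter-reject (_<? m) {xs = l} y≮m)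

below-self : ∀ (m : Fin n) l → below m (m ∷ l) ≡ below m l
below-self m l = below-∷-≮ l (<-irrefl refl)

below-++ : ∀ (m : Fin n) l l′ → below m (l ++ l′) ≡ below m l + below m l′
below-++ m l l′ = trans (cong length (filter-++ (_<? m) l l′)) (length-++ (filter (_<? m) l))

below-cross : ∀ {x y : Fin n} l l′ → x ≢ y → below x (y ∷ l) + below y (x ∷ l′) ≡ suc (below x l + below y l′)
below-cross {x = x} {y} l l′ x≢y with <-cmp x y
... | tri< x<y _ y≮x = trans (cong₂ _+_ (below-∷-≮ l y≮x) (below-∷-< l′ x<y)) (+-suc (below x l) (below y l′))
... | tri≈ _ x≡y _   = ⊥-elim (x≢y x≡y)
... | tri> _ _ y<x   = cong₂ _+_ (below-∷-< l y<x) (below-∷-≮ l′ (<-asym y<x))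

fromList : List (Fin n) → Subset n
fromList []      = ∅
fromList (x ∷ l) = ⁅ x ⁆ ∪ fromList l

∈-fromList⁺ : ∀ {z : Fin n} {l} → z ∈ l → z ∈ₛ fromList l
∈-fromList⁺ (here refl) = x∈p∪q⁺ (inj₁ (x∈⁅x⁆ _))
∈-fromList⁺ (there z∈l) = x∈p∪q⁺ (inj₂ (∈-fromList⁺ z∈l))

∈-fromList⁻ : ∀ {z : Fin n} l → z ∈ₛ fromList l → z ∈ l
∈-fromList⁻ []      z∈⊥ = ⊥-elim (∉⊥ z∈⊥)
∈-fromList⁻ (x ∷ l) z∈  = [ here ∘ x∈⁅y⁆⇒x≡y x , there ∘ ∈-fromList⁻ l ]′ (x∈p∪q⁻ ⁅ x ⁆ (fromList l) z∈)

∣⁅x⁆∪p∣≡1+∣p∣ : ∀ (x : Fin n) p → x ∉ₛ p → ∣ ⁅ x ⁆ ∪ p ∣ ≡ suc ∣ p ∣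
∣⁅x⁆∪p∣≡1+∣p∣ Fin.zero    (inside  ∷ p) x∉p = ⊥-elim (x∉p Vec.here)
∣⁅x⁆∪p∣≡1+∣p∣ Fin.zero    (outside ∷ p) x∉p = cong (suc ∘ ∣_∣) (∪-identityˡ p)
∣⁅x⁆∪p∣≡1+∣p∣ (Fin.suc x) (inside  ∷ p) x∉p = cong suc (∣⁅x⁆∪p∣≡1+∣p∣ x p (x∉p ∘ Vec.there))
∣⁅x⁆∪p∣≡1+∣p∣ (Fin.suc x) (outside ∷ p) x∉p = ∣⁅x⁆∪p∣≡1+∣p∣ x p (x∉p ∘ Vec.there)

∉-fromList : ∀ {x : Fin n} {l} → All (x ≢_) l → x ∉ₛ fromList l
∉-fromList {l = l} x≢l = All¬⇒¬Any x≢l ∘ ∈-fromList⁻ l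

∣fromList∣≡length : ∀ {l : List (Fin n)} → Unique l → ∣ fromList l ∣ ≡ length l
∣fromList∣≡length {n = n} {[]}    _           = ∣⊥∣≡0 n
∣fromList∣≡length {l = x ∷ l} (x≢l ∷ l!) = trans (∣⁅x⁆∪p∣≡1+∣p∣ x (fromList l) (∉-fromList x≢l)) (cong suc (∣fromList∣≡length l!))

fromList-ordering : ∀ {l : List (Fin n)} → Unique l → IsOrdering l (fromList l)
fromList-ordering {l = l} l! = l! , λ z → mk⇔ ∈-fromList⁺ (∈-fromList⁻ l)

ordering⇒fromList : ∀ {l : List (Fin n)} {S} → IsOrdering l S → S ≡ fromList l
ordering⇒fromList {l = l} (_ , l⇔S) =
  ⊆-antisym (λ z∈S → ∈-fromList⁺ (Equivalence.from (l⇔S _) z∈S))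
            (λ z∈l → Equivalence.to (l⇔S _) (∈-fromList⁻ l z∈l))

length-ordering : ∀ {l : List (Fin n)} {S} → IsOrdering l S → length l ≡ ∣ S ∣
length-ordering ord@(l! , _) = trans (sym (∣fromList∣≡length l!)) (cong ∣_∣ (sym (ordering⇒fromList ord)))

fromList-swap : ∀ (x y : Fin n) l → fromList (x ∷ y ∷ l) ≡ fromList (y ∷ x ∷ l)
fromList-swap x y l = begin
  ⁅ x ⁆ ∪ (⁅ y ⁆ ∪ fromList l)   ≡⟨ sym (∪-assoc ⁅ x ⁆ ⁅ y ⁆ (fromList l)) ⟩
  (⁅ x ⁆ ∪ ⁅ y ⁆) ∪ fromList l   ≡⟨ cong (_∪ fromList l) (∪-comm ⁅ x ⁆ ⁅ y ⁆) ⟩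
  (⁅ y ⁆ ∪ ⁅ x ⁆) ∪ fromList l   ≡⟨ ∪-assoc ⁅ y ⁆ ⁅ x ⁆ (fromList l) ⟩
  ⁅ y ⁆ ∪ (⁅ x ⁆ ∪ fromList l)   ∎

fromList-∩ : ∀ {m m′ : Fin n} l → m ≢ m′ → fromList (m ∷ l) ∩ fromList (m′ ∷ l) ≡ fromList l
fromList-∩ {m = m} {m′} l m≢m′ = ⊆-antisym ∩⊆ (λ z∈l → x∈p∩q⁺ (q⊆p∪q ⁅ m ⁆ _ z∈l , q⊆p∪q ⁅ m′ ⁆ _ z∈l))
  where
  common : ∀ {z} → z ∈ m ∷ l → z ∈ m′ ∷ l → z ∈ l
  common (here refl) (here refl) = ⊥-elim (m≢m′ refl)
  common (here refl) (there z∈l) = z∈l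
  common (there z∈l) _           = z∈l
  ∩⊆ : fromList (m ∷ l) ∩ fromList (m′ ∷ l) ⊆ fromList l
  ∩⊆ z∈∩ with x∈p∩q⁻ (fromList (m ∷ l)) (fromList (m′ ∷ l)) z∈∩
  ... | z∈ , z∈′ = ∈-fromList⁺ (common (∈-fromList⁻ (m ∷ l) z∈) (∈-fromList⁻ (m′ ∷ l) z∈′))

below-resp-fromList : ∀ (m : Fin n) {l l′} → Unique l → Unique l′ → fromList l ≡ fromList l′ → below m l ≡ below m l′
below-resp-fromList m {l} {l′} l! l′! l≡l′ = begin
  below m l                     ≡⟨ sym (∣fromList∣≡length (filter⁺ (_<? m) l!)) ⟩
  ∣ fromList (filter (_<? m) l) ∣  ≡⟨ cong ∣_∣ (⊆-antisym (filtered l l′ l≡l′) (filtered l′ l (sym l≡l′))) ⟩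
  ∣ fromList (filter (_<? m) l′) ∣ ≡⟨ ∣fromList∣≡length (filter⁺ (_<? m) l′!) ⟩
  below m l′                    ∎
  where
  filtered : ∀ k k′ → fromList k ≡ fromList k′ → fromList (filter (_<? m) k) ⊆ fromList (filter (_<? m) k′)
  filtered k k′ k≡k′ z∈ with ∈-filter⁻ (_<? m) {xs = k} (∈-fromList⁻ (filter (_<? m) k) z∈)
  ... | z∈k , z<m = ∈-fromList⁺ (∈-filter⁺ (_<? m) (∈-fromList⁻ k′ (subst (_ ∈ₛ_) k≡k′ (∈-fromList⁺ z∈k))) z<m)

split-at-first : ∀ {m : Fin n} {R} → m ∉ R → ∀ O → m ∈ O → (∀ {z} → z ∈ O → z ∈ m ∷ R) →
                 ∃₂ λ P S → O ≡ P ++ m ∷ S × All (_∈ R) P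
split-at-first m∉R []      ()  _
split-at-first m∉R (y ∷ O) m∈O O⊆ with O⊆ (here refl)
... | here refl = [] , O , refl , []
... | there y∈R with m∈O
...   | here refl = ⊥-elim (m∉R y∈R)
...   | there m∈O′ with split-at-first m∉R O m∈O′ (O⊆ ∘ there)
...     | P , S , refl , P⊆R = y ∷ P , S , refl , y∈R ∷ P⊆R

missing-++ : ∀ {m : Fin n} {R} P S → All (_∈ R) P → m ∉ R → missing (P ++ m ∷ S) R ≡ just (length P , P ++ S)
missing-++ {m = m} {R} [] S [] m∉R with DecMembership._∈?_ _≟_ m R
... | yes m∈R = ⊥-elim (m∉R m∈R)
... | no _    = refl
missing-++ {m = m} {R} (y ∷ P) S (y∈R ∷ P⊆R) m∉R with DecMembership._∈?_ _≟_ y R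
... | yes _   rewrite missing-++ P S P⊆R m∉R = refl
... | no y∉R  = ⊥-elim (y∉R y∈R)

incidence-missing : ∀ (σ ρ : List (Fin n)) {i σ′} → missing σ ρ ≡ just (i , σ′) →
                    incidence σ ρ ≡ signPow (i + inversions σ′ + inversions ρ)
incidence-missing σ ρ eq with missing σ ρ
incidence-missing σ ρ refl | just _ = refl

-- The inversions involving m are the elements of P above m and those of S below m; adding
-- below m (P ++ m ∷ S) completes the former to length P and doubles the latter.
inversions-remove : ∀ {m : Fin n} P S → m ∉ P →
  inversions (P ++ m ∷ S) + below m (P ++ m ∷ S) ≡ length P + inversions (P ++ S) + (below m S + below m S)
inversions-remove {m = m} [] S _ = begin
  below m S + inversions S + below m (m ∷ S)  ≡⟨ cong (below m S + inversions S +_) (below-self m S) ⟩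
  below m S + inversions S + below m S        ≡⟨ regroup₀ (below m S) (inversions S) ⟩
  inversions S + (below m S + below m S)      ∎
  where
  regroup₀ : ∀ c i → c + i + c ≡ i + (c + c)
  regroup₀ = solve-∀
inversions-remove {m = m} (y ∷ P) S m∉y∷P = begin
  below y Q + inversions Q + below m (y ∷ Q)
    ≡⟨ cong (λ t → t + inversions Q + below m (y ∷ Q)) (below-++ y P (m ∷ S)) ⟩
  below y P + below y (m ∷ S) + inversions Q + below m (y ∷ Q)
    ≡⟨ regroup₁ (below y P) (below y (m ∷ S)) (inversions Q) (below m (y ∷ Q)) ⟩
  below y P + inversions Q + (below m (y ∷ Q) + below y (m ∷ S))
    ≡⟨ cong (below y P + inversions Q +_) (below-cross Q S (m∉y∷P ∘ here)) ⟩
  below y P + inversions Q + suc (below m Q + below y S)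
    ≡⟨ regroup₂ (below y P) (inversions Q) (below m Q) (below y S) ⟩
  suc (below y P + below y S + (inversions Q + below m Q))
    ≡⟨ cong (λ t → suc (below y P + below y S + t)) (inversions-remove P S (m∉y∷P ∘ there)) ⟩
  suc (below y P + below y S + (length P + inversions (P ++ S) + (c + c)))
    ≡⟨ regroup₃ (below y P) (below y S) (length P) (inversions (P ++ S)) c ⟩
  suc (length P) + (below y P + below y S + inversions (P ++ S)) + (c + c)
    ≡⟨ cong (λ t → suc (length P) + (t + inversions (P ++ S)) + (c + c)) (sym (below-++ y P S)) ⟩
  suc (length P) + (below y (P ++ S) + inversions (P ++ S)) + (c + c)
    ∎
  where
  Q : List (Fin _)
  Q = P ++ m ∷ S
  c : ℕ
  c = below m S
  regroup₁ : ∀ a b i d → a + b + i + d ≡ a + i + (d + b)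
  regroup₁ = solve-∀
  regroup₂ : ∀ a i e f → a + i + suc (e + f) ≡ suc (a + f + (i + e))
  regroup₂ = solve-∀
  regroup₃ : ∀ a f l i c → suc (a + f + (l + i + (c + c))) ≡ suc l + (a + f + i) + (c + c)
  regroup₃ = solve-∀

incidence-split : ∀ {m : Fin n} {R} P S → All (_∈ R) P → m ∉ R →
  incidence (P ++ m ∷ S) R ≡ signPow (inversions (P ++ m ∷ S) + below m (P ++ m ∷ S) + inversions R)
incidence-split {m = m} {R} P S P⊆R m∉R = begin
  incidence (P ++ m ∷ S) R
    ≡⟨ incidence-missing (P ++ m ∷ S) R (missing-++ P S P⊆R m∉R) ⟩
  signPow (length P + inversions (P ++ S) + inversions R)
    ≡⟨ signPow-+ (length P + inversions (P ++ S)) (inversions R) ⟩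
  signPow (length P + inversions (P ++ S)) * signPow (inversions R)
    ≡⟨ cong (_* signPow (inversions R)) (sym (signPow-+-double (length P + inversions (P ++ S)) (below m S))) ⟩
  signPow (length P + inversions (P ++ S) + (below m S + below m S)) * signPow (inversions R)
    ≡⟨ cong (λ t → signPow t * signPow (inversions R)) (sym (inversions-remove P S m∉P)) ⟩
  signPow (inversions (P ++ m ∷ S) + below m (P ++ m ∷ S)) * signPow (inversions R)
    ≡⟨ sym (signPow-+ (inversions (P ++ m ∷ S) + below m (P ++ m ∷ S)) (inversions R)) ⟩
  signPow (inversions (P ++ m ∷ S) + below m (P ++ m ∷ S) + inversions R)
    ∎
  where
  m∉P : m ∉ P
  m∉P m∈P = m∉R (All.lookup P⊆R m∈P)

incidence-facet : ∀ {O : List (Fin n)} {m R} → IsOrdering O (fromList (m ∷ R)) → Unique (m ∷ R) →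
                  incidence O R ≡ signPow (inversions O + below m R + inversions R)
incidence-facet {O = O} {m} {R} ord@(O! , O⇔) mR!@(m≢R ∷ _) =
  trans (at-split (split-at-first m∉R O m∈O O⊆m∷R))
        (cong (λ t → signPow (inversions O + t + inversions R)) below-O)
  where
  m∉R : m ∉ R
  m∉R = All¬⇒¬Any m≢R
  m∈O : m ∈ O
  m∈O = Equivalence.from (O⇔ m) (∈-fromList⁺ {l = m ∷ R} (here refl))
  O⊆m∷R : ∀ {z} → z ∈ O → z ∈ m ∷ R
  O⊆m∷R z∈O = ∈-fromList⁻ (m ∷ R) (Equivalence.to (O⇔ _) z∈O)
  at-split : (∃₂ λ P S → O ≡ P ++ m ∷ S × All (_∈ R) P) →
             incidence O R ≡ signPow (inversions O + below m O + inversions R)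
  at-split (P , S , O≡ , P⊆R) =
    subst (λ O → incidence O R ≡ signPow (inversions O + below m O + inversions R)) (sym O≡)
          (incidence-split P S P⊆R m∉R)
  below-O : below m O ≡ below m R
  below-O = trans (below-resp-fromList m {O} {m ∷ R} O! mR! (sym (ordering⇒fromList ord))) (below-self m R)

signPow-odd : ∀ a → signPow (suc (a + a)) ≡ Sign.-
signPow-odd a = cong opposite (signPow-double a)

signPow-odd-cycle : ∀ a b c p q r s t w →
  signPow (a + p) ≡ signPow (b + q) → signPow (b + r) ≡ signPow (c + s) → signPow (c + t) ≡ signPow (a + w) →
  signPow (p + w + (q + r) + (s + t)) ≡ Sign.+
signPow-odd-cycle a b c p q r s t w e₁ e₂ e₃ = begin
  signPow (p + w + (q + r) + (s + t))
    ≡⟨ sym (signPow-+-double (p + w + (q + r) + (s + t)) (a + b + c)) ⟩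
  signPow (p + w + (q + r) + (s + t) + (a + b + c + (a + b + c)))
    ≡⟨ cong signPow (regroup a b c p q r s t w) ⟩
  signPow ((a + p + (b + q)) + ((b + r + (c + s)) + (c + t + (a + w))))
    ≡⟨ signPow-+ (a + p + (b + q)) _ ⟩
  signPow (a + p + (b + q)) * signPow ((b + r + (c + s)) + (c + t + (a + w)))
    ≡⟨ cong (signPow (a + p + (b + q)) *_) (signPow-+ (b + r + (c + s)) (c + t + (a + w))) ⟩
  signPow (a + p + (b + q)) * (signPow (b + r + (c + s)) * signPow (c + t + (a + w)))
    ≡⟨ cong₂ _*_ (signPow-sum-even (a + p) (b + q) e₁)
                  (cong₂ _*_ (signPow-sum-even (b + r) (c + s) e₂) (signPow-sum-even (c + t) (a + w) e₃)) ⟩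
  Sign.+ ∎
  where
  regroup : ∀ a b c p q r s t w →
    p + w + (q + r) + (s + t) + (a + b + c + (a + b + c)) ≡ a + p + (b + q) + (b + r + (c + s) + (c + t + (a + w)))
  regroup = solve-∀

signPow-below-triangle : ∀ {x y v : Fin n} U → x ≢ y → v ≢ y → x ≢ v →
  signPow (below x (y ∷ U) + below y (x ∷ U) + (below v (y ∷ U) + below y (v ∷ U)) + (below x (v ∷ U) + below v (x ∷ U)))
    ≡ Sign.-
signPow-below-triangle {x = x} {y} {v} U x≢y v≢y x≢v = begin
  signPow (below x (y ∷ U) + below y (x ∷ U) + (below v (y ∷ U) + below y (v ∷ U)) + (below x (v ∷ U) + below v (x ∷ U)))
    ≡⟨ cong signPow (cong₂ _+_ (cong₂ _+_ (below-cross U U x≢y) (below-cross U U v≢y)) (below-cross U U x≢v)) ⟩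
  signPow (suc (X + Y) + suc (V + Y) + suc (X + V))
    ≡⟨ cong signPow (regroup X Y V) ⟩
  signPow (suc (suc (X + Y + V) + suc (X + Y + V)))
    ≡⟨ signPow-odd (suc (X + Y + V)) ⟩
  Sign.- ∎
  where
  X = below x U
  Y = below y U
  V = below v U
  regroup : ∀ X Y V → suc (X + Y) + suc (V + Y) + suc (X + V) ≡ suc (suc (X + Y + V) + suc (X + Y + V))
  regroup = solve-∀

module _ (Γ : SimplicialComplex n) where

  component-kface : ∀ {j σ₀ σ} → KFace Γ j σ₀ → InComponent Γ j σ₀ σ → KFace Γ j σ
  component-kface kσ₀ ε             = kσ₀
  component-kface _   (adj ◅ steps) = component-kface (proj₁ (proj₂ adj)) steps

  fromList-kface : ∀ {T j m R} → Face Γ T → All (_∈ₛ T) (m ∷ R) → Unique (m ∷ R) → length R ≡ j →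
                   KFace Γ j (fromList (m ∷ R))
  fromList-kface {T = T} {m = m} {R} T-face m∷R⊆T m∷R! |R|≡j =
    downClosed Γ (fromList (m ∷ R)) T T-face (m , ∈-fromList⁺ {l = m ∷ R} (here refl))
               (All.lookup m∷R⊆T ∘ ∈-fromList⁻ (m ∷ R)) ,
    trans (∣fromList∣≡length m∷R!) (cong suc |R|≡j)

  ridge-kface : ∀ {j m R} → KFace Γ (suc j) (fromList (m ∷ R)) → Unique (m ∷ R) → KFace Γ j (fromList R)
  ridge-kface {m = m} {[]} (_ , |m|≡2+j) m!          with trans (sym (∣fromList∣≡length m!)) |m|≡2+j
  ... | ()
  ridge-kface {m = m} {r ∷ R} (m∷R-face , |m∷R|≡2+j) m∷R!@(_ ∷ R!) =
    downClosed Γ (fromList (r ∷ R)) (fromList (m ∷ r ∷ R)) m∷R-face (r , ∈-fromList⁺ {l = r ∷ R} (here refl))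
               (q⊆p∪q ⁅ m ⁆ _) ,
    trans (∣fromList∣≡length R!) (suc-injective (trans (sym (∣fromList∣≡length m∷R!)) |m∷R|≡2+j))

  ridge-downAdj : ∀ {j F F′ m m′ R} → KFace Γ (suc j) F → KFace Γ (suc j) F′ →
                  F ≡ fromList (m ∷ R) → F′ ≡ fromList (m′ ∷ R) → m ≢ m′ → Unique (m ∷ R) →
                  DownAdj Γ (suc j) F F′
  ridge-downAdj {j = j} {m = m} {m′} {R} kF kF′ refl refl m≢m′ m∷R!@(m≢R ∷ _) =
    kF , kF′ , F≢F′ , subst (KFace Γ j) (sym (fromList-∩ R m≢m′)) (ridge-kface kF m∷R!)
    where
    F≢F′ : fromList (m ∷ R) ≢ fromList (m′ ∷ R)
    F≢F′ F≡F′ with ∈-fromList⁻ (m′ ∷ R) (subst (m ∈ₛ_) F≡F′ (∈-fromList⁺ {l = m ∷ R} (here refl)))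
    ... | here m≡m′ = m≢m′ m≡m′
    ... | there m∈R = All¬⇒¬Any m≢R m∈R

module _ (Γ : SimplicialComplex n) {k σ₀} (kσ₀ : KFace Γ (suc k) σ₀) (coherent : Coherent Γ (suc k) σ₀) where

  private
    o : Subset n → List (Fin n)
    o = proj₁ coherent
    o-ordering : ∀ σ → InComponent Γ (suc k) σ₀ σ → IsOrdering (o σ) σ
    o-ordering = proj₁ (proj₂ coherent)
    o-coherent : ∀ σ σ′ ρ̲ ρ → InComponent Γ (suc k) σ₀ σ → InComponent Γ (suc k) σ₀ σ′ →
                 KFace Γ k ρ̲ → ρ̲ ⊆ σ → ρ̲ ⊆ σ′ → IsOrdering ρ ρ̲ → incidence (o σ) ρ ≡ incidence (o σ′) ρ
    o-coherent = proj₂ (proj₂ coherent)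

  coherent-across : ∀ {F F′ m m′ R} → InComponent Γ (suc k) σ₀ F → InComponent Γ (suc k) σ₀ F′ →
    F ≡ fromList (m ∷ R) → F′ ≡ fromList (m′ ∷ R) → Unique (m ∷ R) → Unique (m′ ∷ R) →
    signPow (inversions (o F) + below m R) ≡ signPow (inversions (o F′) + below m′ R)
  coherent-across {F} {F′} {m} {m′} {R} F∈C F′∈C refl refl m∷R! m′∷R!@(_ ∷ R!) =
    signPow-cancelʳ (inversions (o F) + below m R) (inversions (o F′) + below m′ R) (inversions R) (begin
      signPow (inversions (o F) + below m R + inversions R)    ≡⟨ sym (incidence-facet (o-ordering F F∈C) m∷R!) ⟩
      incidence (o F) R                                       ≡⟨ o-coherent F F′ (fromList R) R F∈C F′∈C ridge
                                                                   (q⊆p∪q ⁅ m ⁆ _) (q⊆p∪q ⁅ m′ ⁆ _) (fromList-ordering R!) ⟩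
      incidence (o F′) R                                      ≡⟨ incidence-facet (o-ordering F′ F′∈C) m′∷R! ⟩
      signPow (inversions (o F′) + below m′ R + inversions R) ∎)
    where
    ridge : KFace Γ k (fromList R)
    ridge = ridge-kface Γ (component-kface Γ kσ₀ F∈C) m∷R!

  coface-incoherent : ∀ {T v x y U} → Face Γ T → All (_∈ₛ T) (v ∷ x ∷ y ∷ U) → Unique (v ∷ x ∷ y ∷ U) →
                      InComponent Γ (suc k) σ₀ (fromList (x ∷ y ∷ U)) → ⊥
  coface-incoherent {v = v} {x} {y} {U} T-face (v∈T ∷ x∈T ∷ y∈T ∷ U⊆T)
                    ((v≢x ∷ v≢y ∷ v≢U) ∷ (x≢y ∷ x≢U) ∷ y≢U ∷ U!) σ∈C =
    s≢opposite[s] Sign.+ (trans (sym crossings-even) crossings-odd)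
    where
    σ A B : Subset _
    σ = fromList (x ∷ y ∷ U)
    A = fromList (v ∷ y ∷ U)
    B = fromList (v ∷ x ∷ U)

    xyU! : Unique (x ∷ y ∷ U)
    xyU! = (x≢y ∷ x≢U) ∷ y≢U ∷ U!
    yxU! : Unique (y ∷ x ∷ U)
    yxU! = (≢-sym x≢y ∷ y≢U) ∷ x≢U ∷ U!
    vyU! : Unique (v ∷ y ∷ U)
    vyU! = (v≢y ∷ v≢U) ∷ y≢U ∷ U!
    yvU! : Unique (y ∷ v ∷ U)
    yvU! = (≢-sym v≢y ∷ y≢U) ∷ v≢U ∷ U!
    vxU! : Unique (v ∷ x ∷ U)
    vxU! = (v≢x ∷ v≢U) ∷ x≢U ∷ U!
    xvU! : Unique (x ∷ v ∷ U)
    xvU! = (≢-sym v≢x ∷ x≢U) ∷ v≢U ∷ U!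

    kσ : KFace Γ (suc k) σ
    kσ = component-kface Γ kσ₀ σ∈C
    |U|≡k : length U ≡ k
    |U|≡k = suc-injective (suc-injective (trans (sym (∣fromList∣≡length xyU!)) (proj₂ kσ)))
    A∈C : InComponent Γ (suc k) σ₀ A
    A∈C = σ∈C ◅◅ (ridge-downAdj Γ kσ (fromList-kface Γ T-face (v∈T ∷ y∈T ∷ U⊆T) vyU! (cong suc |U|≡k))
                                refl refl (≢-sym v≢x) xyU! ◅ ε)
    B∈C : InComponent Γ (suc k) σ₀ B
    B∈C = σ∈C ◅◅ (ridge-downAdj Γ kσ (fromList-kface Γ T-face (v∈T ∷ x∈T ∷ U⊆T) vxU! (cong suc |U|≡k))
                                (fromList-swap x y U) refl (≢-sym v≢y) yxU! ◅ ε)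

    E₁ : signPow (inversions (o σ) + below x (y ∷ U)) ≡ signPow (inversions (o A) + below v (y ∷ U))
    E₁ = coherent-across σ∈C A∈C refl refl xyU! vyU!
    E₂ : signPow (inversions (o A) + below y (v ∷ U)) ≡ signPow (inversions (o B) + below x (v ∷ U))
    E₂ = coherent-across A∈C B∈C (fromList-swap v y U) (fromList-swap v x U) yvU! xvU!
    E₃ : signPow (inversions (o B) + below v (x ∷ U)) ≡ signPow (inversions (o σ) + below y (x ∷ U))
    E₃ = coherent-across B∈C σ∈C refl (fromList-swap x y U) vxU! yxU!

    crossings : ℕ
    crossings = below x (y ∷ U) + below y (x ∷ U) + (below v (y ∷ U) + below y (v ∷ U))
              + (below x (v ∷ U) + below v (x ∷ U))
    crossings-even : signPow crossings ≡ Sign.+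
    crossings-even = signPow-odd-cycle (inversions (o σ)) (inversions (o A)) (inversions (o B))
      (below x (y ∷ U)) (below v (y ∷ U)) (below y (v ∷ U)) (below x (v ∷ U)) (below v (x ∷ U)) (below y (x ∷ U))
      E₁ E₂ E₃
    crossings-odd : signPow crossings ≡ Sign.-
    crossings-odd = signPow-below-triangle U x≢y v≢y (≢-sym v≢x)

  no-proper-coface : ∀ {σ T v} → InComponent Γ (suc k) σ₀ σ → Face Γ T → σ ⊆ T → v ∈ₛ T → v ∉ₛ σ → ⊥
  no-proper-coface {σ} {T} {v} σ∈C T-face σ⊆T v∈T v∉σ =
    via (o σ) ord (trans (length-ordering ord) (proj₂ (component-kface Γ kσ₀ σ∈C)))
    where
    ord : IsOrdering (o σ) σ
    ord = o-ordering σ σ∈C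
    via : ∀ L → IsOrdering L σ → length L ≡ suc (suc k) → ⊥
    via []          _ ()
    via (_ ∷ [])    _ ()
    via (x ∷ y ∷ U) ord@(L! , L⇔σ) _ =
      coface-incoherent T-face (v∈T ∷ All.tabulate (σ⊆T ∘ Equivalence.to (L⇔σ _)))
                        (¬Any⇒All¬ (x ∷ y ∷ U) (v∉σ ∘ Equivalence.to (L⇔σ v)) ∷ L!)
                        (subst (InComponent Γ (suc k) σ₀) (ordering⇒fromList ord) σ∈C)

proposition2p4 : (n : ℕ) (Γ : SimplicialComplex n) (k : ℕ) (σ₀ : Subset n) →
    KFace Γ (suc k) σ₀ → Coherent Γ (suc k) σ₀ →
    ∀ σ → InComponent Γ (suc k) σ₀ σ → Leaf Γ σ
proposition2p4 n Γ k σ₀ kσ₀ coherent σ σ∈C = proj₁ (component-kface Γ kσ₀ σ∈C) , maximal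
  where
  maximal : ∀ T → Face Γ T → σ ⊆ T → T ≡ σ
  maximal T T-face σ⊆T =
    ⊆-antisym (λ {z} z∈T → decidable-stable (z ∈? σ) (no-proper-coface Γ kσ₀ coherent σ∈C T-face σ⊆T z∈T)) σ⊆T
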